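{- Let $P$ be a normal logic program. Then $P$ has a $\le_s$-minimal stable trap space, and $P$ has a $\le_s$-minimal supported trap space. Here a stable (resp. supported) trap space $I$ is $\le_s$-minimal if there is no stable (resp. supported) trap space $J$ with $J \le_s I$ and $J \neq I$.
   Context: Fix a first-order language with finitely many constant, function and predicate symbols. A normal logic program (NLP) $P$ is a finite set of rules $p \leftarrow p_1,\dots,p_m, \mathord{\sim} p_{m+1},\dots,\mathord{\sim} p_k$ ($k\ge m\ge 0$, atoms $p,p_i$, $\mathord{\sim}$ default negation). $\mathrm{HB}(P)$ is its Herbrand base (possibly infinite), $\mathrm{gr}(P)$ its ground instantiation; for a ground rule $r$, $\mathrm{head}(r)$ is its head, $B^+(r)=\{p_1,\dots,p_m\}$, $B^-(r)=\{p_{m+1},\dots,p_k\}$, and $\mathrm{bf}(r)=\bigwedge_{v\in B^+(r)}v\wedge\bigwedge_{v\in B^-(r)}\neg v$ (equal to $1$ if the body is empty). A three-valued interpretation is a map $I:\mathrm{HB}(P)\to\{0,1,\star\}$; it is two-valued if it never takes value $\star$, and two-valued interpretations are identified with subsets of $\mathrm{HB}(P)$ (the true atoms). For three-valued $I$, $[I]=\{J\subseteq \mathrm{HB}(P) : \forall a\in\mathrm{HB}(P),\ I(a)\neq\star\Rightarrow J(a)=I(a)\}$. The order $\le_s$ on $\{0,1,\star\}$ is given by $0<_s\star$, $1<_s\star$ (no other strict relations), extended pointwise; equivalently $I_1\le_s I_2$ iff $[I_1]\subseteq[I_2]$. Formulas are evaluated in three-valued (Kleene) logic: $\neg 1=0,\neg0=1,\neg\star=\star$,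 conjunction is minimum and disjunction is maximum w.r.t. $0<_t\star<_t1$. For $a\in\mathrm{HB}(P)$ and an interpretation $I$, $I(\mathrm{rhs}(a))$ is the $\le_t$-maximum of $I(\mathrm{bf}(r))$ over all $r\in\mathrm{gr}(P)$ with $\mathrm{head}(r)=a$, and $0$ if there is no such rule. For a two-valued $I$: $T_P(I)$ is the two-valued interpretation with $T_P(I)(a)=I(\mathrm{rhs}(a))$ for all $a$; $F_P(I)$ is the $\subseteq$-least model of the Gelfond–Lifschitz reduct of $\mathrm{gr}(P)$ w.r.t. $I$ (delete every rule having some $b\in B^-(r)$ with $b\in I$, then delete all remaining negative literals). A nonempty set $S$ of two-valued interpretations is a stable trap set if $\{F_P(I): I\in S\}\subseteq S$, and a supported trap set if $\{T_P(I): I\in S\}\subseteq S$. A three-valued interpretation $I$ is a stable (resp. supported) trap space if $[I]$ is a stable (resp. supported) trap set. -}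

module Defs where

open import Data.Nat using (ℕ)
open import Data.Fin using (Fin)
open import Data.Vec using (Vec; []; _∷_)
open import Data.List using (List)
open import Data.List.Membership.Propositional using (_∈_)
open import Data.List.Relation.Unary.All using (All)
open import Data.Bool using (Bool; true; false)
open import Data.Product using (Σ; ∃; _×_; _,_)
open import Data.Empty using (⊥)
open import Relation.Nullary using (¬_)
open import Relation.Binary.PropositionalEquality using (_≡_)

record Signature : Set where
  field
    nConst    : ℕ
    nFun      : ℕ
    funArity  : Fin nFun → ℕ
    nPred     : ℕ
    predArity : Fin nPred → ℕ

module _ (L : Signature) where
  open Signature L

  data Term (V : Set) : Set where
    var   : V → Term V
    const : Fin nConst → Term V
    app   : (f : Fin nFun) → Vec (Term V) (funArity f) → Term V

  record Atom (V : Set) : Set where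
    constructor atom
    field
      pred : Fin nPred
      args : Vec (Term V) (predArity pred)

  GTerm : Set
  GTerm = Term ⊥

  GAtom : Set
  GAtom = Atom ⊥

  mutual
    substT : {V : Set} → (V → GTerm) → Term V → GTerm
    substT σ (var x)    = σ x
    substT σ (const c)  = const c
    substT σ (app f ts) = app f (substTs σ ts)

    substTs : {V : Set} {n : ℕ} → (V → GTerm) → Vec (Term V) n → Vec GTerm n
    substTs σ []       = []
    substTs σ (t ∷ ts) = substT σ t ∷ substTs σ ts

  substA : {V : Set} → (V → GTerm) → Atom V → GAtom
  substA σ (atom p ts) = atom p (substTs σ ts)

  record Rule : Set where
    field
      nVars : ℕ
      head  : Atom (Fin nVars)
      pos   : List (Atom (Fin nVars))
      neg   : List (Atom (Fin nVars))

  Program : Set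
  Program = List Rule

  Interp2 : Set
  Interp2 = GAtom → Bool

  -- a ground rule of gr(P): an instance of some r ∈ P under a ground
  -- substitution σ of its variables.  We quantify over (r ∈ P, σ).

  BodyTrue : Interp2 → (r : Rule) → (Fin (Rule.nVars r) → GTerm) → Set
  BodyTrue I r σ =
    All (λ b → I (substA σ b) ≡ true)  (Rule.pos r) ×
    All (λ b → I (substA σ b) ≡ false) (Rule.neg r)

  IsTP : Program → Interp2 → Interp2 → Set
  IsTP P I J = (a : GAtom) →
    (J a ≡ true → Σ Rule λ r → r ∈ P × Σ (Fin (Rule.nVars r) → GTerm) λ σ →
        substA σ (Rule.head r) ≡ a × BodyTrue I r σ)
    × ((Σ Rule λ r → r ∈ P × Σ (Fin (Rule.nVars r) → GTerm) λ σ →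
        substA σ (Rule.head r) ≡ a × BodyTrue I r σ) → J a ≡ true)

  -- K is a model of the Gelfond–Lifschitz reduct of gr(P) w.r.t. I
  ModelOfReduct : Program → Interp2 → Interp2 → Set
  ModelOfReduct P I K = (r : Rule) → r ∈ P → (σ : Fin (Rule.nVars r) → GTerm) →
    All (λ b → I (substA σ b) ≡ false) (Rule.neg r) →
    All (λ b → K (substA σ b) ≡ true) (Rule.pos r) →
    K (substA σ (Rule.head r)) ≡ true

  IsFP : Program → Interp2 → Interp2 → Set
  IsFP P I J = ModelOfReduct P I J ×
    ((K : Interp2) → ModelOfReduct P I K → (a : GAtom) → J a ≡ true → K a ≡ true)

  StableTrapSet : Program → (Interp2 → Set) → Set
  StableTrapSet P S = (∃ λ I → S I) ×
    ((I J : Interp2) → S I → IsFP P I J → S J)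

  SupportedTrapSet : Program → (Interp2 → Set) → Set
  SupportedTrapSet P S = (∃ λ I → S I) ×
    ((I J : Interp2) → S I → IsTP P I J → S J)

data V3 : Set where
  v0 v1 ⋆ : V3

toV3 : Bool → V3
toV3 false = v0
toV3 true  = v1

data _≤s_ : V3 → V3 → Set where
  ≤s-refl : ∀ {x} → x ≤s x
  0≤s⋆    : v0 ≤s ⋆
  1≤s⋆    : v1 ≤s ⋆

module _ (L : Signature) where

  Interp3 : Set
  Interp3 = GAtom L → V3

  Cube : Interp3 → Interp2 L → Set
  Cube I J = (a : GAtom L) → ¬ (I a ≡ ⋆) → I a ≡ toV3 (J a)

  _≤S_ : Interp3 → Interp3 → Set
  I₁ ≤S I₂ = (a : GAtom L) → I₁ a ≤s I₂ a

  _≐_ : Interp3 → Interp3 → Set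
  I₁ ≐ I₂ = (a : GAtom L) → I₁ a ≡ I₂ a

  StableTrapSpace : Program L → Interp3 → Set
  StableTrapSpace P I = StableTrapSet L P (Cube I)

  SupportedTrapSpace : Program L → Interp3 → Set
  SupportedTrapSpace P I = SupportedTrapSet L P (Cube I)

  Minimal : (Interp3 → Set) → Interp3 → Set
  Minimal X I = X I ×
    ((J : Interp3) → X J → J ≤S I → ¬ (J ≐ I) → ⊥)

-- law of excluded middle (the paper's classical metatheory)
open import Relation.Nullary using (Dec)
ExcludedMiddle : Set₁
ExcludedMiddle = (A : Set) → Dec A

{-# OPTIONS --safe #-}
module Submission where

-- A greedy descent through the countable Herbrand base. Enumerate the
-- ground atoms a₀, a₁, … and start from the all-⋆ trap space; at step k,
-- if some trap space below the current one fixes aₖ, move to it. The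
-- pointwise limit of this descending chain is again a trap space, since
-- every fixed atom of the limit is already fixed, with the same value, at
-- some finite stage. It is minimal: a trap space strictly below it would
-- fix some atom aₖ left at ⋆ by the limit, but then step k would have
-- fixed aₖ. Nothing about F_P or T_P is used beyond their being relations
-- on two-valued interpretations.

open import Defs
open import Data.Bool using (Bool; true; false)
open import Data.Empty using (⊥; ⊥-elim)
open import Data.Fin using (Fin; toℕ)
open import Data.Fin.Properties using (toℕ-injective)
open import Data.Nat using (ℕ; zero; suc; _≤′_; ≤′-reflexive; ≤′-step)
open import Data.Nat.Binary using (ℕᵇ; zero; 2[1+_]; 1+[2_])
open import Data.Nat.Binary.Properties using (2[1+_]-injective; 1+[2_]-injective)
import Data.Nat.Binary as ℕᵇ
import Data.Nat.Binary.Properties as ℕᵇ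
open import Data.Nat.Properties using (≤-total; ≤⇒≤′)
open import Data.Product using (Σ; ∃; _×_; _,_; proj₁; proj₂)
open import Data.Sum using (inj₁; inj₂)
open import Data.Vec using (Vec; []; _∷_)
open import Function using (_∘_)
open import Function.Bundles using (_↣_; mk↣; Injection)
open import Relation.Nullary using (¬_; Dec; yes; no)
open import Relation.Binary.PropositionalEquality using (_≡_; _≢_; refl; sym; trans)

≤s-reflexive : ∀ {x y} → x ≡ y → x ≤s y
≤s-reflexive refl = ≤s-refl

≤s-trans : ∀ {x y z} → x ≤s y → y ≤s z → x ≤s z
≤s-trans ≤s-refl y≤z     = y≤z
≤s-trans 0≤s⋆   ≤s-refl = 0≤s⋆
≤s-trans 1≤s⋆   ≤s-refl = 1≤s⋆

⋆≤s : ∀ {y} → ¬ y ≢ ⋆ → ⋆ ≤s y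
⋆≤s {v0} ¬y≢⋆ = ⊥-elim (¬y≢⋆ λ ())
⋆≤s {v1} ¬y≢⋆ = ⊥-elim (¬y≢⋆ λ ())
⋆≤s {⋆}  _    = ≤s-refl

≤s-non⋆⇒≡ : ∀ {x y} → x ≤s y → y ≢ ⋆ → x ≡ y
≤s-non⋆⇒≡ ≤s-refl _   = refl
≤s-non⋆⇒≡ 0≤s⋆   y≢⋆ = ⊥-elim (y≢⋆ refl)
≤s-non⋆⇒≡ 1≤s⋆   y≢⋆ = ⊥-elim (y≢⋆ refl)

≤s-fixed⇒≡ : ∀ {x y} → x ≤s y → (x ≢ ⋆ → y ≢ ⋆) → x ≡ y
≤s-fixed⇒≡ ≤s-refl _     = refl
≤s-fixed⇒≡ 0≤s⋆   fixed = ⊥-elim (fixed (λ ()) refl)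
≤s-fixed⇒≡ 1≤s⋆   fixed = ⊥-elim (fixed (λ ()) refl)

-- Codes are bit strings (ℕᵇ) written in continuation-passing style: each
-- encoder prepends a prefix-free code to the string it is given, so
-- injectivity reduces to injectivity of the constructors of ℕᵇ.

encode-ℕ : ℕ → ℕᵇ → ℕᵇ
encode-ℕ zero    r = 1+[2 r ]
encode-ℕ (suc n) r = 2[1+ encode-ℕ n r ]

encode-ℕ-injective : ∀ m n {r s} → encode-ℕ m r ≡ encode-ℕ n s → m ≡ n × r ≡ s
encode-ℕ-injective zero    zero    e = refl , 1+[2_]-injective e
encode-ℕ-injective (suc m) (suc n) e with encode-ℕ-injective m n (2[1+_]-injective e)
... | refl , r≡s = refl , r≡s
encode-ℕ-injective zero    (suc n) ()
encode-ℕ-injective (suc m) zero    ()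

encode-Fin : ∀ {n} → Fin n → ℕᵇ → ℕᵇ
encode-Fin = encode-ℕ ∘ toℕ

encode-Fin-injective : ∀ {n} (i j : Fin n) {r s} → encode-Fin i r ≡ encode-Fin j s → i ≡ j × r ≡ s
encode-Fin-injective i j e with encode-ℕ-injective (toℕ i) (toℕ j) e
... | i≡j , r≡s = toℕ-injective i≡j , r≡s

module AtomEncoding (L : Signature) where

  mutual
    encode-term : GTerm L → ℕᵇ → ℕᵇ
    encode-term (var ())
    encode-term (const c)  r = 1+[2 encode-Fin c r ]
    encode-term (app f ts) r = 2[1+ encode-Fin f (encode-terms ts r) ]

    encode-terms : ∀ {n} → Vec (GTerm L) n → ℕᵇ → ℕᵇ
    encode-terms []       r = r
    encode-terms (t ∷ ts) r = encode-term t (encode-terms ts r)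

  mutual
    encode-term-injective : ∀ t u {r s} → encode-term t r ≡ encode-term u s → t ≡ u × r ≡ s
    encode-term-injective (var ()) _
    encode-term-injective _ (var ())
    encode-term-injective (const c) (const d) e with encode-Fin-injective c d (1+[2_]-injective e)
    ... | refl , r≡s = refl , r≡s
    encode-term-injective (app f ts) (app g us) e with encode-Fin-injective f g (2[1+_]-injective e)
    ... | refl , codes≡ with encode-terms-injective ts us codes≡
    ...   | refl , r≡s = refl , r≡s
    encode-term-injective (const c)  (app g us) ()
    encode-term-injective (app f ts) (const d)  ()

    encode-terms-injective : ∀ {n} (ts us : Vec (GTerm L) n) {r s} →
      encode-terms ts r ≡ encode-terms us s → ts ≡ us × r ≡ s
    encode-terms-injective []       []       e = refl , e
    encode-terms-injective (t ∷ ts) (u ∷ us) e with encode-term-injective t u e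
    ... | refl , codes≡ with encode-terms-injective ts us codes≡
    ...   | refl , r≡s = refl , r≡s

  encode-atom : GAtom L → ℕ
  encode-atom (atom p ts) = ℕᵇ.toℕ (encode-Fin p (encode-terms ts zero))

  encode-atom-injective : ∀ {a b} → encode-atom a ≡ encode-atom b → a ≡ b
  encode-atom-injective {atom p ts} {atom q us} e
    with encode-Fin-injective p q (ℕᵇ.toℕ-injective e)
  ... | refl , codes≡ with encode-terms-injective ts us codes≡
  ...   | refl , _ = refl

  GAtom↣ℕ : GAtom L ↣ ℕ
  GAtom↣ℕ = mk↣ encode-atom-injective

module _ (L : Signature) where

  TrapSet : (Interp2 L → Interp2 L → Set) → (Interp2 L → Set) → Set
  TrapSet R S = (∃ λ x → S x) × ((x y : Interp2 L) → S x → R x y → S y)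

  TrapSpace : (Interp2 L → Interp2 L → Set) → Interp3 L → Set
  TrapSpace R I = TrapSet R (Cube L I)

  cube-inhabited : ∀ I → ∃ (Cube L I)
  cube-inhabited I = (λ a → choose (I a)) , (λ a → choose-agrees (I a))
    where
    choose : V3 → Bool
    choose v1 = true
    choose _  = false

    choose-agrees : ∀ v → v ≢ ⋆ → v ≡ toV3 (choose v)
    choose-agrees v0 _   = refl
    choose-agrees v1 _   = refl
    choose-agrees ⋆  v≢⋆ = ⊥-elim (v≢⋆ refl)

  cube-mono : ∀ {I J} → _≤S_ L I J → ∀ x → Cube L I x → Cube L J x
  cube-mono I≤J x x∈I a Ja≢⋆ =
    trans (sym I≡J) (x∈I a λ Ia≡⋆ → Ja≢⋆ (trans (sym I≡J) Ia≡⋆))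
    where I≡J = ≤s-non⋆⇒≡ (I≤J a) Ja≢⋆

  all-⋆ : Interp3 L
  all-⋆ _ = ⋆

  all-⋆-trapSpace : ∀ R → TrapSpace R all-⋆
  all-⋆-trapSpace R = cube-inhabited all-⋆ , λ _ _ _ _ _ ⋆≢⋆ → ⊥-elim (⋆≢⋆ refl)

  antitone : (T : ℕ → Interp3 L) → (∀ k → _≤S_ L (T (suc k)) (T k)) →
    ∀ {m n} → m ≤′ n → _≤S_ L (T n) (T m)
  antitone T desc (≤′-reflexive refl) a = ≤s-refl
  antitone T desc (≤′-step m≤′n)      a = ≤s-trans (desc _ a) (antitone T desc m≤′n a)

  module DescendingMeet (lem : ExcludedMiddle) (T : ℕ → Interp3 L)
    (desc : ∀ k → _≤S_ L (T (suc k)) (T k)) where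

    FixedSomewhere : GAtom L → Set
    FixedSomewhere a = ∃ λ n → T n a ≢ ⋆

    meetAt : ∀ a → Dec (FixedSomewhere a) → V3
    meetAt a (yes (n , _)) = T n a
    meetAt a (no _)        = ⋆

    meet : Interp3 L
    meet a = meetAt a (lem (FixedSomewhere a))

    meet-≤ : ∀ n → _≤S_ L meet (T n)
    meet-≤ n a with lem (FixedSomewhere a)
    ... | no never-fixed = ⋆≤s λ Tna≢⋆ → never-fixed (n , Tna≢⋆)
    ... | yes (m , Tma≢⋆) with ≤-total n m
    ...   | inj₁ n≤m = antitone T desc (≤⇒≤′ n≤m) a
    ...   | inj₂ m≤n = ≤s-reflexive (sym (≤s-non⋆⇒≡ (antitone T desc (≤⇒≤′ m≤n) a) Tma≢⋆))

    meet-fixed : ∀ n a → T n a ≢ ⋆ → meet a ≢ ⋆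
    meet-fixed n a Tna≢⋆ with lem (FixedSomewhere a)
    ... | yes (m , Tma≢⋆) = Tma≢⋆
    ... | no never-fixed  = λ _ → never-fixed (n , Tna≢⋆)

    meet-attained : ∀ a → meet a ≢ ⋆ → ∃ λ m → meet a ≡ T m a
    meet-attained a meet≢⋆ with lem (FixedSomewhere a)
    ... | yes (m , _) = m , refl
    ... | no _        = ⊥-elim (meet≢⋆ refl)

    meet-trapSpace : ∀ {R} → (∀ n → TrapSpace R (T n)) → TrapSpace R meet
    meet-trapSpace {R} traps = cube-inhabited meet , closed
      where
      closed : (x y : Interp2 L) → Cube L meet x → R x y → Cube L meet y
      closed x y x∈meet Rxy a meet≢⋆ with meet-attained a meet≢⋆
      ... | m , meet≡T =
        trans meet≡T (proj₂ (traps m) x y (cube-mono (meet-≤ m) x x∈meet) Rxy a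
                        λ Tma≡⋆ → meet≢⋆ (trans meet≡T Tma≡⋆))

  module Greedy (lem : ExcludedMiddle) (code : GAtom L ↣ ℕ)
    (R : Interp2 L → Interp2 L → Set) where

    open Injection code using (injective) renaming (to to encode)

    TrapSpaceOf : Set
    TrapSpaceOf = Σ (Interp3 L) (TrapSpace R)

    Fixes : Interp3 L → ℕ → Set
    Fixes J k = ∃ λ a → encode a ≡ k × J a ≢ ⋆

    RefinementFixing : TrapSpaceOf → ℕ → Set
    RefinementFixing (I , _) k = Σ (Interp3 L) λ J → TrapSpace R J × _≤S_ L J I × Fixes J k

    refine : (I : TrapSpaceOf) (k : ℕ) → Dec (RefinementFixing I k) → TrapSpaceOf
    refine I k (yes (J , J-trap , _)) = J , J-trap
    refine I k (no _)                 = I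

    refine-≤ : ∀ I k d → _≤S_ L (proj₁ (refine I k d)) (proj₁ I)
    refine-≤ I k (yes (_ , _ , J≤I , _)) = J≤I
    refine-≤ I k (no _)                  = λ _ → ≤s-refl

    refine-fixes : ∀ I k d → RefinementFixing I k → Fixes (proj₁ (refine I k d)) k
    refine-fixes I k (yes (_ , _ , _ , J-fixes)) _ = J-fixes
    refine-fixes I k (no none)                   r = ⊥-elim (none r)

    greedy : ℕ → TrapSpaceOf
    greedy zero    = all-⋆ , all-⋆-trapSpace R
    greedy (suc k) = refine (greedy k) k (lem (RefinementFixing (greedy k) k))

    open DescendingMeet lem (proj₁ ∘ greedy) (λ k → refine-≤ (greedy k) k (lem (RefinementFixing (greedy k) k)))

    fixed-below-meet : ∀ J → TrapSpace R J → _≤S_ L J meet → ∀ a → J a ≢ ⋆ → meet a ≢ ⋆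
    fixed-below-meet J J-trap J≤meet a Ja≢⋆ with
      refine-fixes (greedy k) k (lem (RefinementFixing (greedy k) k))
        (J , J-trap , (λ b → ≤s-trans (J≤meet b) (meet-≤ k b)) , a , refl , Ja≢⋆)
      where k = encode a
    ... | b , code-b≡code-a , fixes-b with injective code-b≡code-a
    ...   | refl = meet-fixed (suc (encode a)) a fixes-b

    minimal-trapSpace : ∃ (Minimal L (TrapSpace R))
    minimal-trapSpace = meet , meet-trapSpace (proj₂ ∘ greedy) , below-meet-≐
      where
      below-meet-≐ : (J : Interp3 L) → TrapSpace R J → _≤S_ L J meet → ¬ _≐_ L J meet → ⊥
      below-meet-≐ J J-trap J≤meet J≢meet =
        J≢meet λ a → ≤s-fixed⇒≡ (J≤meet a) (fixed-below-meet J J-trap J≤meet a)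

theorem3p1 : ExcludedMiddle → (L : Signature) → (P : Program L) →
    (∃ λ I → Minimal L (StableTrapSpace L P) I) ×
    (∃ λ I → Minimal L (SupportedTrapSpace L P) I)
theorem3p1 lem L P =
  Greedy.minimal-trapSpace L lem GAtom↣ℕ (IsFP L P) ,
  Greedy.minimal-trapSpace L lem GAtom↣ℕ (IsTP L P)
  where open AtomEncoding L using (GAtom↣ℕ)
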